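{- Let $\mathcal A=(\{0,1\};\cdot)$ where $x\cdot y=\neg x\wedge\neg y$. Then $\mathcal A$ does not have relational width $(2,l)$ for any $l\ge2$.
   Context: Homomorphisms commute with operations. $\mathrm{graph}(\mathcal A)$ is the relational structure on the same domain with the ternary relation $\{(a,b,a\cdot b)\}$ (in general, for each $k$-ary operation $f$, the relation $\{(a_1,\dots,a_k,f(a_1,\dots,a_k))\}$, plus the relations of the structure). Let $X,A$ be sets, $k$ an integer, and $\mathcal P=(P_K)$ indexed by $K\subseteq X$ with $|K|\le k$, $P_K\subseteq A^K$. For $L\subseteq X$ and $C\subseteq A^L$, $\mathcal P$ has the $k$-forth property for $C$ if for every $K\subseteq L$, $|K|\le k$, and $f\in P_K$ there is $g\in C$ with $g|_K=f$ and $g|_{K'}\in P_{K'}$ for all $K'\subseteq L$ with $|K'|\le k$. For $l\ge k$, $\mathcal P$ is a $(k,l)$-system if it has the $k$-forth property for $A^L$ for all $L\subseteq X$ with $|L|\le l$; non-trivial if no $P_K$ is empty; compatible with a structure $\mathcal X$ (domain $X$) if it also has the $k$-forth property for $\{g:L\to A\mid(g(y_1),\dots,g(y_n))\in R^{\mathrm{graph}(\mathcal A)}\}$ for each relation $R$ of the graph signature and each $(y_1,\dots,y_n)\in R^{\mathrm{graph}(\mathcal X)}$, $L=\{y_1,\dots,y_n\}$. $\mathcal A$ has relational width $(k,l)$ if every finite structure $\mathcal X$ of the same signature with a non-trivial compatible $(k,l)$-system has a homomorphism to $\mathcal A$. -}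

module Defs where

open import Data.Nat using (ℕ; _≤_)
open import Data.Bool using (Bool; not; _∧_)
open import Data.Fin using (Fin)
open import Data.Fin.Subset using (Subset; _∈_; _⊆_; ∣_∣; ⁅_⁆; _∪_)
open import Data.Unit using (⊤)
open import Data.Product using (Σ; ∃; _×_; _,_)
open import Relation.Binary.PropositionalEquality using (_≡_)

-- An element of A^K is represented by a
-- total function  Fin n → A  whose values outside K are ignored; all
-- comparisons are "agreement on K".  A family P = (P_K) is a predicate
-- P K : (Fin n → A) → Set, representing P_K = { f|_K | P K f } ⊆ A^K
-- (every subset of A^K arises this way).

module _ {A : Set} where

  AgreeOn : ∀ {n} → Subset n → (Fin n → A) → (Fin n → A) → Set
  AgreeOn K f g = ∀ x → x ∈ K → f x ≡ g x

  Family : ℕ → Set₁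
  Family n = Subset n → (Fin n → A) → Set

  RestrIn : ∀ {n} → Family n → Subset n → (Fin n → A) → Set
  RestrIn P K g = Σ (Fin _ → A) λ f → P K f × AgreeOn K f g

  ForthProperty : ∀ {n} → ℕ → Family n → (L : Subset n) → ((Fin n → A) → Set) → Set
  ForthProperty {n} k P L C =
    ∀ (K : Subset n) → K ⊆ L → ∣ K ∣ ≤ k → ∀ f → P K f →
      Σ (Fin n → A) λ g → C g × AgreeOn K g f ×
        (∀ (K' : Subset n) → K' ⊆ L → ∣ K' ∣ ≤ k → RestrIn P K' g)

  -- (k,l)-system (only the components P_K with |K| ≤ k are ever used)
  IsSystem : ∀ {n} → ℕ → ℕ → Family n → Set
  IsSystem {n} k l P = ∀ (L : Subset n) → ∣ L ∣ ≤ l → ForthProperty k P L (λ _ → ⊤)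

  NonTrivial : ∀ {n} → ℕ → Family n → Set
  NonTrivial {n} k P = ∀ (K : Subset n) → ∣ K ∣ ≤ k → Σ (Fin n → A) λ f → P K f

  -- compatibility with X = (Fin n; op), target A = (A; _·_):
  -- for each (y1,y2,y3) in the graph relation of X, i.e. y3 = op y1 y2,
  -- k-forth for { g : L → A | g y3 = g y1 · g y2 },  L = {y1,y2,y3}
  Compatible : ∀ {n} → (A → A → A) → (Fin n → Fin n → Fin n) → ℕ → Family n → Set
  Compatible _·_ op k P = ∀ y₁ y₂ →
    ForthProperty k P (⁅ y₁ ⁆ ∪ ⁅ y₂ ⁆ ∪ ⁅ op y₁ y₂ ⁆)
      (λ g → g (op y₁ y₂) ≡ g y₁ · g y₂)

  IsHom : ∀ {n} → (Fin n → Fin n → Fin n) → (A → A → A) → (Fin n → A) → Set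
  IsHom op _·_ h = ∀ a b → h (op a b) ≡ h a · h b

  RelationalWidth : (A → A → A) → ℕ → ℕ → Set₁
  RelationalWidth _·_ k l =
    ∀ (n : ℕ) (op : Fin n → Fin n → Fin n) (P : Family n) →
      NonTrivial k P → IsSystem k l P → Compatible _·_ op k P →
      Σ (Fin n → A) λ h → IsHom op _·_ h

nor : Bool → Bool → Bool
nor x y = not x ∧ not y

-- The counterexample X has four core points, their negations and the two constants.
-- Keep the five Boolean assignments σ of X that make at most one core point true, negate
-- on the negated points and fix the constants.  They satisfy σ(x·y) = nor(σx, σy) unless
-- x, y are distinct core points, and their restrictions to at most two points form a
-- (2,l)-system for every l.  It is compatible: on each product triple, a kept assignment
-- changed at the one point of the triple outside the given pair solves the triple and is,
-- off any single point of the triple, again a kept assignment (a finite check).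
-- Yet X has no homomorphism to (Bool; nor): nor is commutative, so a homomorphism
-- identifies a·b with b·a, and for distinct core points a, b these are the two other
-- core points.  Hence it is constant on the core, with value t = nor(t,t) = ¬t.

module Submission where

open import Defs
open import Data.Nat using (ℕ; _≤_)
open import Data.Bool using (Bool)
open import Relation.Nullary using (¬_)

open import Data.Nat using (_<_; _<?_)
open import Data.Nat.Properties using (≤-<-trans; <⇒≱)
open import Data.Bool using (true; false; not; if_then_else_)
open import Data.Bool.Properties using (∧-comm; ∧-idem; not-¬) renaming (_≟_ to _≟ᵇ_)
open import Data.Fin using (Fin; suc; splitAt; join)
open import Data.Fin.Patterns using (0F; 1F; 2F; 3F)
open import Data.Fin.Properties using (all?; any?; ¬∀⟶∃¬) renaming (_≟_ to _≟ᶠ_)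
open import Data.Fin.Subset using (Subset; _∈_; _∉_; _⊆_; ∣_∣; ⁅_⁆; _∪_; _-_)
open import Data.Fin.Subset.Properties using (_∈?_; p⊆q⇒∣p∣≤∣q∣; x∈p∧x≢y⇒x∈p-y)
open import Data.Vec.Functional using (updateAt)
open import Data.Vec.Functional.Properties using (updateAt-minimal)
open import Data.Product using (∃; _×_; _,_; uncurry)
open import Data.Sum using (_⊎_; inj₁; inj₂; [_,_]′) renaming (map₂ to ⊎-map₂)
open import Data.Unit using (tt)
open import Data.Empty using (⊥-elim)
open import Function using (_∘_; const)
open import Relation.Nullary using (Dec; does)
open import Relation.Nullary.Decidable using (map′; _⊎-dec_; _×-dec_; _→-dec_; from-yes; decidable-stable)
open import Relation.Unary using (Decidable)
open import Relation.Binary.PropositionalEquality using (_≡_; refl; sym; trans; cong; module ≡-Reasoning)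

∣p∣<∣q∣⇒∃∈q∉p : ∀ {n} {p q : Subset n} → ∣ p ∣ < ∣ q ∣ → ∃ λ x → x ∈ q × x ∉ p
∣p∣<∣q∣⇒∃∈q∉p {n} {p} {q} ∣p∣<∣q∣ =
  let x , ¬[x∈q⇒x∈p] = ¬∀⟶∃¬ n (λ x → x ∈ q → x ∈ p) (λ x → x ∈? q →-dec x ∈? p) q⊈p
  in x , decidable-stable (x ∈? q) (λ x∉q → ¬[x∈q⇒x∈p] (⊥-elim ∘ x∉q)) , ¬[x∈q⇒x∈p] ∘ const
  where
  q⊈p : ¬ (∀ x → x ∈ q → x ∈ p)
  q⊈p q⊆p = <⇒≱ ∣p∣<∣q∣ (p⊆q⇒∣p∣≤∣q∣ (q⊆p _))

module _ {A : Set} {m n : ℕ} (S : Fin m → Fin n → A) where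

  Restrictions : Family n
  Restrictions K f = ∃ λ i → AgreeOn K (S i) f

  restriction-∈ : ∀ i K → RestrIn Restrictions K (S i)
  restriction-∈ i K = S i , (i , λ _ _ → refl) , λ _ _ → refl

  restrictions-nonTrivial : Fin m → ∀ k → NonTrivial k Restrictions
  restrictions-nonTrivial i k K _ = S i , i , λ _ _ → refl

  forth-closed : ∀ {k} L (C : (Fin n → A) → Set) → (∀ i → C (S i)) → ForthProperty k Restrictions L C
  forth-closed L C C-S K _ _ f (i , Sᵢ≈f) = S i , C-S i , Sᵢ≈f , λ K′ _ _ → restriction-∈ i K′

  restrictions-isSystem : ∀ k l → IsSystem k l Restrictions
  restrictions-isSystem k l L _ = forth-closed L _ (λ _ → tt)

  patch : Fin m → Fin n → A → Fin n → A
  patch i x v = updateAt (S i) x (const v)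

  KeptOffEachPoint : Subset n → (Fin n → A) → Set
  KeptOffEachPoint L g = ∀ y → y ∈ L → ∃ λ j → AgreeOn (L - y) (S j) g

  Patchable : Subset n → ((Fin n → A) → Set) → Set
  Patchable L C = ∀ i x → x ∈ L → ∃ λ v → C (patch i x v) × KeptOffEachPoint L (patch i x v)

  patch-agrees : ∀ {K i x v f} → x ∉ K → AgreeOn K (S i) f → AgreeOn K (patch i x v) f
  patch-agrees {i = i} {x} x∉K Sᵢ≈f y y∈K =
    trans (updateAt-minimal y x (S i) (λ { refl → x∉K y∈K })) (Sᵢ≈f y y∈K)

  keptOffEachPoint⇒restrIn : ∀ {k} {L : Subset n} {g} → k < ∣ L ∣ → KeptOffEachPoint L g →
                             ∀ K → K ⊆ L → ∣ K ∣ ≤ k → RestrIn Restrictions K g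
  keptOffEachPoint⇒restrIn k<∣L∣ kept-off K K⊆L ∣K∣≤k =
    let y , y∈L , y∉K = ∣p∣<∣q∣⇒∃∈q∉p (≤-<-trans ∣K∣≤k k<∣L∣)
        j , Sⱼ≈g = kept-off y y∈L
    in S j , (j , λ _ _ → refl) ,
       λ z z∈K → Sⱼ≈g z (x∈p∧x≢y⇒x∈p-y (K⊆L z∈K) (λ { refl → y∉K z∈K }))

  forth-patched : ∀ {k} L (C : (Fin n → A) → Set) → k < ∣ L ∣ → Patchable L C →
                  ForthProperty k Restrictions L C
  forth-patched L C k<∣L∣ patchable K _ ∣K∣≤k f (i , Sᵢ≈f) =
    let x , x∈L , x∉K = ∣p∣<∣q∣⇒∃∈q∉p (≤-<-trans ∣K∣≤k k<∣L∣)
        v , C-patch , kept-off = patchable i x x∈L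
    in patch i x v , C-patch , patch-agrees x∉K Sᵢ≈f ,
       keptOffEachPoint⇒restrIn k<∣L∣ kept-off

∃-Bool? : {P : Bool → Set} → Decidable P → Dec (∃ P)
∃-Bool? P? = map′ [ (false ,_) , (true ,_) ]′ (λ { (false , p) → inj₁ p ; (true , p) → inj₂ p })
                  (P? false ⊎-dec P? true)

agreeOn? : ∀ {n} (K : Subset n) (f g : Fin n → Bool) → Dec (AgreeOn K f g)
agreeOn? K f g = all? λ x → x ∈? K →-dec f x ≟ᵇ g x

keptOffEachPoint? : ∀ {m n} (S : Fin m → Fin n → Bool) L g → Dec (KeptOffEachPoint S L g)
keptOffEachPoint? S L g = all? λ y → y ∈? L →-dec any? λ j → agreeOn? (L - y) (S j) g

patchable? : ∀ {m n} (S : Fin m → Fin n → Bool) L {C : (Fin n → Bool) → Set} → Decidable C →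
             Dec (Patchable S L C)
patchable? S L C? =
  all? λ i → all? λ x → x ∈? L →-dec ∃-Bool? λ v →
    C? (patch S i x v) ×-dec keptOffEachPoint? S L (patch S i x v)

Point : Set
Point = Fin 4 ⊎ Fin 4 ⊎ Fin 2

pattern core a = inj₁ a
pattern neg a = inj₂ (inj₁ a)
pattern 𝟘 = inj₂ (inj₂ 0F)
pattern 𝟙 = inj₂ (inj₂ 1F)

-- For a ≠ b the product is the smaller of the two other core points if a < b and the
-- larger one if a > b, so that a·b and b·a are exactly the two other core points.
_∙ᶜ_ : Fin 4 → Fin 4 → Point
0F ∙ᶜ 0F = neg 0F
0F ∙ᶜ 1F = core 2F
0F ∙ᶜ 2F = core 1F
0F ∙ᶜ 3F = core 1F
1F ∙ᶜ 0F = core 3F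
1F ∙ᶜ 1F = neg 1F
1F ∙ᶜ 2F = core 0F
1F ∙ᶜ 3F = core 0F
2F ∙ᶜ 0F = core 3F
2F ∙ᶜ 1F = core 3F
2F ∙ᶜ 2F = neg 2F
2F ∙ᶜ 3F = core 0F
3F ∙ᶜ 0F = core 2F
3F ∙ᶜ 1F = core 2F
3F ∙ᶜ 2F = core 1F
3F ∙ᶜ 3F = neg 3F

_∙_ : Point → Point → Point
core a ∙ core b = a ∙ᶜ b
core a ∙ neg b  = if does (a ≟ᶠ b) then 𝟘 else core b
neg a  ∙ core b = if does (a ≟ᶠ b) then 𝟘 else core a
neg a  ∙ neg b  = if does (a ≟ᶠ b) then core a else 𝟘
core a ∙ 𝟘      = neg a
neg a  ∙ 𝟘      = core a
𝟘      ∙ core a = neg a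
𝟘      ∙ neg a  = core a
𝟘      ∙ 𝟘      = 𝟙
_      ∙ 𝟙      = 𝟘
𝟙      ∙ _      = 𝟘

assignment : Fin 5 → Point → Bool
assignment i (core a) = does (i ≟ᶠ suc a)
assignment i (neg a)  = not (assignment i (core a))
assignment i 𝟘        = false
assignment i 𝟙        = true

decode : Fin 10 → Point
decode x = ⊎-map₂ (splitAt 4) (splitAt 4 x)

encode : Point → Fin 10
encode = join 4 6 ∘ ⊎-map₂ (join 4 2)

op : Fin 10 → Fin 10 → Fin 10
op x y = encode (decode x ∙ decode y)

kept : Fin 5 → Fin 10 → Bool
kept i = assignment i ∘ decode

triple : Fin 10 → Fin 10 → Subset 10
triple y₁ y₂ = ⁅ y₁ ⁆ ∪ ⁅ y₂ ⁆ ∪ ⁅ op y₁ y₂ ⁆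

Solves : Fin 10 → Fin 10 → (Fin 10 → Bool) → Set
Solves y₁ y₂ g = g (op y₁ y₂) ≡ nor (g y₁) (g y₂)

solves? : ∀ y₁ y₂ → Decidable (Solves y₁ y₂)
solves? y₁ y₂ g = g (op y₁ y₂) ≟ᵇ nor (g y₁) (g y₂)

ClosedOrPatchable : Fin 10 → Fin 10 → Set
ClosedOrPatchable y₁ y₂ =
  (∀ i → Solves y₁ y₂ (kept i)) ⊎ (2 < ∣ triple y₁ y₂ ∣ × Patchable kept (triple y₁ y₂) (Solves y₁ y₂))

-- Decided by evaluation.  A product triple with a repeated point leaves no room for
-- patching, so there every kept assignment must already solve it.
closedOrPatchable : ∀ y₁ y₂ → ClosedOrPatchable y₁ y₂
closedOrPatchable = from-yes (all? λ y₁ → all? λ y₂ →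
  all? (solves? y₁ y₂ ∘ kept) ⊎-dec (2 <? ∣ triple y₁ y₂ ∣ ×-dec patchable? kept (triple y₁ y₂) (solves? y₁ y₂)))

compatible : Compatible nor op 2 (Restrictions kept)
compatible y₁ y₂ = [ forth-closed kept L C , uncurry (forth-patched kept L C) ]′ (closedOrPatchable y₁ y₂)
  where
  L = triple y₁ y₂
  C = Solves y₁ y₂

hom-nor-swap : ∀ {n} {_·_ : Fin n → Fin n → Fin n} {h} → IsHom _·_ nor h → ∀ x y → h (x · y) ≡ h (y · x)
hom-nor-swap {h = h} hom x y = trans (hom x y) (trans (∧-comm (not (h x)) (not (h y))) (sym (hom y x)))

no-hom : ∀ h → ¬ IsHom op nor h
no-hom h hom = not-¬ refl t≡¬t
  where
  c : Fin 4 → Fin 10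
  c = encode ∘ core
  swap : ∀ x y → h (op x y) ≡ h (op y x)
  swap = hom-nor-swap {_·_ = op} {h} hom
  h₂≡h₃ : h (c 2F) ≡ h (c 3F)
  h₂≡h₃ = swap (c 0F) (c 1F)
  h₀≡h₁ : h (c 0F) ≡ h (c 1F)
  h₀≡h₁ = swap (c 2F) (c 3F)
  h₁≡h₃ : h (c 1F) ≡ h (c 3F)
  h₁≡h₃ = swap (c 0F) (c 2F)
  open ≡-Reasoning
  t≡¬t : h (c 0F) ≡ not (h (c 0F))
  t≡¬t = begin
    h (c 0F)                   ≡⟨ trans h₀≡h₁ (trans h₁≡h₃ (sym h₂≡h₃)) ⟩
    h (c 2F)                   ≡⟨ hom (c 0F) (c 1F) ⟩
    nor (h (c 0F)) (h (c 1F))  ≡⟨ cong (nor (h (c 0F))) (sym h₀≡h₁) ⟩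
    nor (h (c 0F)) (h (c 0F))  ≡⟨ ∧-idem (not (h (c 0F))) ⟩
    not (h (c 0F))             ∎

proposition35 : ∀ (l : ℕ) → 2 ≤ l → ¬ RelationalWidth {Bool} nor 2 l
proposition35 l _ width =
  let h , hom = width 10 op (Restrictions kept)
                  (restrictions-nonTrivial kept 0F 2) (restrictions-isSystem kept 2 l) compatible
  in no-hom h hom
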